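{- Let $\Gamma$ be a $1$-walk-regular graph with valency $k$, and let $E$ be a $1$-walk-regular idempotent of rank $m$ for an eigenvalue $\theta\neq k$. Then every clique of $\Gamma$ has at most $m+1$ vertices.
   Context: All graphs are finite, simple and connected, with adjacency matrix $A$; $A_0=I$, $A_1=A$. A graph is $1$-walk-regular if it has diameter at least $1$ and for every $\ell\geq0$ the number of walks of length $\ell$ between $x$ and $y$ depends only on $\mathrm{dist}(x,y)$ whenever $\mathrm{dist}(x,y)\leq1$; such a graph is regular. A $1$-walk-regular idempotent for $\theta$ is a nonzero real symmetric matrix $E$ with $E^2=E$, $AE=\theta E$, and constants $\alpha_0,\alpha_1$ with $A_j\circ E=\alpha_jA_j$ for $j=0,1$ ($\circ$ the entrywise product). -}

module Defs where

open import Level using (0ℓ)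
open import Data.Nat as ℕ using (ℕ; zero; suc)
open import Data.Fin using (Fin; zero; suc)
open import Data.Bool using (Bool; true; false; if_then_else_)
open import Data.Product using (Σ; ∃; _×_; _,_)
open import Relation.Nullary using (¬_)
open import Relation.Binary.PropositionalEquality using (_≡_; _≢_)
open import Relation.Binary.Structures using (IsTotalOrder)
open import Data.Fin using (_≟_)
open import Relation.Nullary.Decidable using (⌊_⌋)
import Algebra.Structures as AS

-- The real numbers, given axiomatically as a complete ordered field
-- (unique up to isomorphism).  Equality is propositional equality.

record RealField : Set₁ where
  infixl 6 _+_
  infixl 7 _*_
  infix  4 _≤_
  field
    ℝ   : Set
    _+_ _*_ : ℝ → ℝ → ℝ
    -_  : ℝ → ℝ
    0# 1# : ℝ
    _≤_ : ℝ → ℝ → Set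
    isCommutativeRing : AS.IsCommutativeRing {A = ℝ} _≡_ _+_ _*_ -_ 0# 1#
    0≢1      : 0# ≢ 1#
    inverse  : ∀ x → x ≢ 0# → Σ ℝ (λ y → x * y ≡ 1#)
    isTotalOrder : IsTotalOrder _≡_ _≤_
    +-mono-≤ : ∀ {x y} z → x ≤ y → x + z ≤ y + z
    *-nonneg : ∀ {x y} → 0# ≤ x → 0# ≤ y → 0# ≤ x * y
    complete : (P : ℝ → Set) → Σ ℝ P →
               Σ ℝ (λ b → ∀ x → P x → x ≤ b) →
               Σ ℝ (λ s → (∀ x → P x → x ≤ s) ×
                          (∀ b → (∀ x → P x → x ≤ b) → s ≤ b))

record Graph (n : ℕ) : Set where
  field
    adj   : Fin n → Fin n → Bool
    sym   : ∀ x y → adj x y ≡ adj y x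
    irrefl : ∀ x → adj x x ≡ false

module _ {n : ℕ} (Γ : Graph n) where
  open Graph Γ

  Adj : Fin n → Fin n → Set
  Adj x y = adj x y ≡ true

  sumℕ : ∀ {m} → (Fin m → ℕ) → ℕ
  sumℕ {zero}  f = 0
  sumℕ {suc m} f = f zero ℕ.+ sumℕ (λ i → f (suc i))

  data Reachable : Fin n → Fin n → Set where
    here : ∀ {x} → Reachable x x
    step : ∀ {x y z} → Adj x y → Reachable y z → Reachable x z

  Connected : Set
  Connected = ∀ x y → Reachable x y

  degree : Fin n → ℕ
  degree x = sumℕ (λ z → if adj x z then 1 else 0)

  Regular : ℕ → Set
  Regular k = ∀ x → degree x ≡ k

  -- number of walks of length ℓ from x to y  (= (A^ℓ)_{xy})
  walks : ℕ → Fin n → Fin n → ℕ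
  walks zero    x y = if ⌊ x ≟ y ⌋ then 1 else 0
  walks (suc ℓ) x y = sumℕ (λ z → if adj x z then walks ℓ z y else 0)

  -- 1-walk-regular: diameter ≥ 1 (there is an edge, i.e. ≥ 2 vertices
  -- in a connected graph), and walk counts between vertices at distance
  -- 0, resp. 1, depend only on the distance.
  OneWalkRegular : Set
  OneWalkRegular =
    (∃ λ x → ∃ λ y → Adj x y) ×
    (∀ ℓ x y → walks ℓ x x ≡ walks ℓ y y) ×
    (∀ ℓ x y u v → Adj x y → Adj u v → walks ℓ x y ≡ walks ℓ u v)

  IsClique : ∀ {c} → (Fin c → Fin n) → Set
  IsClique {c} f = (∀ i j → f i ≡ f j → i ≡ j) × (∀ i j → i ≢ j → Adj (f i) (f j))

module Linear (R : RealField) where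
  open RealField R

  Σ[_] : ∀ {m} → (Fin m → ℝ) → ℝ
  Σ[_] {zero}  f = 0#
  Σ[_] {suc m} f = f zero + Σ[ (λ i → f (suc i)) ]

  Matrix : ℕ → Set
  Matrix n = Fin n → Fin n → ℝ

  IndependentColumns : ∀ {n r} → Matrix n → (Fin r → Fin n) → Set
  IndependentColumns E f =
    ∀ (c : Fin _ → ℝ) → (∀ x → Σ[ (λ i → c i * E x (f i)) ] ≡ 0#) → ∀ i → c i ≡ 0#

  HasRank : ∀ {n} → Matrix n → ℕ → Set
  HasRank {n} E m =
    (Σ (Fin m → Fin n) (λ f → IndependentColumns E f)) ×
    (∀ (f : Fin (suc m) → Fin n) → ¬ IndependentColumns E f)

  module _ {n : ℕ} (Γ : Graph n) where
    open Graph Γ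

    Amat : Matrix n
    Amat x y = if adj x y then 1# else 0#

    record OneWalkRegularIdempotent (θ : ℝ) (E : Matrix n) : Set where
      field
        nonzero   : ¬ (∀ x y → E x y ≡ 0#)
        symmetric : ∀ x y → E x y ≡ E y x
        idem      : ∀ x y → Σ[ (λ z → E x z * E z y) ] ≡ E x y
        eigen     : ∀ x y → Σ[ (λ z → Amat x z * E z y) ] ≡ θ * E x y
        α₀ α₁     : ℝ
        diag      : ∀ x → E x x ≡ α₀            -- A₀ ∘ E = α₀ A₀
        offdiag   : ∀ x y → Adj Γ x y → E x y ≡ α₁  -- A₁ ∘ E = α₁ A₁

  fromℕ : ℕ → ℝ
  fromℕ zero    = 0#
  fromℕ (suc k) = 1# + fromℕ k

module Submission where

open import Defs
open import Level using (0ℓ)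
open import Data.Nat as ℕ using (ℕ; suc; _≤_; _≤?_)
open import Data.Nat.Properties using (≰⇒>)
open import Data.Fin using (Fin; zero; suc; inject≤)
open import Data.Fin.Properties using (suc-injective; inject≤-injective)
open import Data.Bool using (Bool; true; false; if_then_else_)
open import Data.Product using (_,_)
open import Data.Sum using (inj₁; inj₂)
open import Function using (_∘_)
open import Relation.Nullary using (¬_; yes; no; contradiction)
open import Relation.Binary.PropositionalEquality
  using (_≡_; _≢_; refl; sym; trans; cong; cong₂; subst; subst₂; module ≡-Reasoning)
open import Relation.Binary.Structures using (IsTotalOrder)
open import Algebra.Bundles using (CommutativeRing)
import Algebra.Properties.Ring as RingProperties
import Algebra.Properties.Group as GroupProperties
import Algebra.Properties.CommutativeSemigroup as CommutativeSemigroupProperties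

-- Taking the (x, x) entry of A E = θ E and using that every neighbour z of x
-- has E z x = α₁ gives θ α₀ = k α₁.  If α₀ = α₁, then θ ≠ k forces α₀ = 0,
-- and a positive semidefinite idempotent with zero diagonal vanishes, since
-- E x x = Σ_z (E x z)²; hence α₀ ≠ α₁.  Now let {e, x₁, …, x_r} be a clique
-- and Σ_i a_i E_{· x_i} = 0.  Rows e and x_j of this relation agree in every
-- term except the j-th, which gives a_j α₁ = a_j α₀, so a_j = 0: the columns
-- x₁, …, x_r are independent and r ≤ m.

¬¬-∀-Fin : ∀ {n} {P : Fin n → Set} → (∀ i → ¬ ¬ P i) → ¬ ¬ (∀ i → P i)
¬¬-∀-Fin {ℕ.zero} ¬¬P ¬∀P = ¬∀P (λ ())
¬¬-∀-Fin {suc n}  ¬¬P ¬∀P =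
  ¬¬P zero λ P₀ → ¬¬-∀-Fin (¬¬P ∘ suc) λ P₊ → ¬∀P λ { zero → P₀ ; (suc i) → P₊ i }

IsClique-inject≤ : ∀ {n} (Γ : Graph n) {c d} {f : Fin c → Fin n} →
                   IsClique Γ f → (d≤c : d ≤ c) → IsClique Γ (λ i → f (inject≤ i d≤c))
IsClique-inject≤ Γ (injective , adjacent) d≤c =
  (λ i j fi≡fj → inject≤-injective d≤c d≤c i j (injective _ _ fi≡fj)) ,
  (λ i j i≢j → adjacent _ _ (i≢j ∘ inject≤-injective d≤c d≤c i j))

module RealFieldProperties (R : RealField) where
  open RealField R renaming (_≤_ to _≤ᵣ_)
  open Linear R
  open ≡-Reasoning

  commutativeRing : CommutativeRing 0ℓ 0ℓ
  commutativeRing = record { isCommutativeRing = isCommutativeRing }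

  open CommutativeRing commutativeRing
    using ( +-comm; +-assoc; +-identityˡ; -‿inverseʳ
          ; *-assoc; *-identityʳ; zeroˡ; distribʳ; ring; +-group; +-commutativeSemigroup )
  open RingProperties ring using (-‿distribˡ-*; -‿distribʳ-*; x[y-z]≈xy-xz)
  open GroupProperties +-group using (⁻¹-involutive; x∙y⁻¹≈ε⇒x≈y)
  open CommutativeSemigroupProperties +-commutativeSemigroup using (xy∙z≈zy∙x)
  private module ≤ = IsTotalOrder isTotalOrder

  x*y≡0⇒x≡0 : ∀ {x y} → y ≢ 0# → x * y ≡ 0# → x ≡ 0#
  x*y≡0⇒x≡0 {x} {y} y≢0 xy≡0 with inverse y y≢0
  ... | y⁻¹ , yy⁻¹≡1 = begin
    x               ≡⟨ *-identityʳ x ⟨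
    x * 1#          ≡⟨ cong (x *_) yy⁻¹≡1 ⟨
    x * (y * y⁻¹)   ≡⟨ *-assoc x y y⁻¹ ⟨
    x * y * y⁻¹     ≡⟨ cong (_* y⁻¹) xy≡0 ⟩
    0# * y⁻¹        ≡⟨ zeroˡ y⁻¹ ⟩
    0#              ∎

  -- Equality of reals is not decidable, so a vanishing square only yields
  -- a doubly negated equation.
  x*x≡0⇒¬¬x≡0 : ∀ {x} → x * x ≡ 0# → ¬ ¬ x ≡ 0#
  x*x≡0⇒¬¬x≡0 xx≡0 x≢0 = x≢0 (x*y≡0⇒x≡0 x≢0 xx≡0)

  *-cancelˡ-≢ : ∀ x {y z} → y ≢ z → x * y ≡ x * z → x ≡ 0#
  *-cancelˡ-≢ x {y} {z} y≢z xy≡xz =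
    x*y≡0⇒x≡0 (y≢z ∘ x∙y⁻¹≈ε⇒x≈y y z) (begin
      x * (y + - z)        ≡⟨ x[y-z]≈xy-xz x y z ⟩
      x * y + - (x * z)    ≡⟨ cong (λ t → t + - (x * z)) xy≡xz ⟩
      x * z + - (x * z)    ≡⟨ -‿inverseʳ (x * z) ⟩
      0#                   ∎)

  -x*-x≡x*x : ∀ x → - x * - x ≡ x * x
  -x*-x≡x*x x = begin
    - x * - x       ≡⟨ -‿distribˡ-* x (- x) ⟨
    - (x * - x)     ≡⟨ cong -_ (-‿distribʳ-* x x) ⟨
    - (- (x * x))   ≡⟨ ⁻¹-involutive (x * x) ⟩
    x * x           ∎

  x≤x+y : ∀ x {y} → 0# ≤ᵣ y → x ≤ᵣ x + y
  x≤x+y x {y} 0≤y = subst₂ _≤ᵣ_ (+-identityˡ x) (+-comm y x) (+-mono-≤ x 0≤y)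

  0≤x+y : ∀ {x y} → 0# ≤ᵣ x → 0# ≤ᵣ y → 0# ≤ᵣ x + y
  0≤x+y {x} 0≤x 0≤y = ≤.trans 0≤x (x≤x+y x 0≤y)

  x+y≡0⇒x≡0 : ∀ {x y} → 0# ≤ᵣ x → 0# ≤ᵣ y → x + y ≡ 0# → x ≡ 0#
  x+y≡0⇒x≡0 {x} 0≤x 0≤y x+y≡0 = ≤.antisym (subst (x ≤ᵣ_) x+y≡0 (x≤x+y x 0≤y)) 0≤x

  0≤x*x : ∀ x → 0# ≤ᵣ x * x
  0≤x*x x with ≤.total 0# x
  ... | inj₁ 0≤x = *-nonneg 0≤x 0≤x
  ... | inj₂ x≤0 = subst (0# ≤ᵣ_) (-x*-x≡x*x x) (*-nonneg 0≤-x 0≤-x)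
    where
    0≤-x : 0# ≤ᵣ - x
    0≤-x = subst₂ _≤ᵣ_ (-‿inverseʳ x) (+-identityˡ (- x)) (+-mono-≤ (- x) x≤0)

  Σ-cong : ∀ {m} {f g : Fin m → ℝ} → (∀ i → f i ≡ g i) → Σ[ f ] ≡ Σ[ g ]
  Σ-cong {ℕ.zero} f≗g = refl
  Σ-cong {suc m}  f≗g = cong₂ _+_ (f≗g zero) (Σ-cong (f≗g ∘ suc))

  Σ-distribʳ : ∀ {m} (f : Fin m → ℝ) c → Σ[ f ] * c ≡ Σ[ (λ i → f i * c) ]
  Σ-distribʳ {ℕ.zero} f c = zeroˡ c
  Σ-distribʳ {suc m}  f c =
    trans (distribʳ c (f zero) _)
          (cong (f zero * c +_) (Σ-distribʳ (f ∘ suc) c))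

  0≤Σ : ∀ {m} {f : Fin m → ℝ} → (∀ i → 0# ≤ᵣ f i) → 0# ≤ᵣ Σ[ f ]
  0≤Σ {ℕ.zero} 0≤f = ≤.refl
  0≤Σ {suc m}  0≤f = 0≤x+y (0≤f zero) (0≤Σ (0≤f ∘ suc))

  Σ≡0⇒≡0 : ∀ {m} {f : Fin m → ℝ} → (∀ i → 0# ≤ᵣ f i) → Σ[ f ] ≡ 0# → ∀ i → f i ≡ 0#
  Σ≡0⇒≡0 {suc m} {f} 0≤f Σf≡0 zero    = x+y≡0⇒x≡0 (0≤f zero) (0≤Σ (0≤f ∘ suc)) Σf≡0
  Σ≡0⇒≡0 {suc m} {f} 0≤f Σf≡0 (suc i) =
    Σ≡0⇒≡0 (0≤f ∘ suc)
      (x+y≡0⇒x≡0 (0≤Σ (0≤f ∘ suc)) (0≤f zero) (trans (+-comm _ (f zero)) Σf≡0)) i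

  Σ-agree-except : ∀ {m} (f g : Fin m → ℝ) j → (∀ i → i ≢ j → f i ≡ g i) →
                   Σ[ f ] + g j ≡ Σ[ g ] + f j
  Σ-agree-except f g zero f≗g = begin
    f zero + Σ[ f ∘ suc ] + g zero   ≡⟨ cong (λ s → f zero + s + g zero) (Σ-cong (λ i → f≗g (suc i) λ ())) ⟩
    f zero + Σ[ g ∘ suc ] + g zero   ≡⟨ xy∙z≈zy∙x (f zero) _ (g zero) ⟩
    g zero + Σ[ g ∘ suc ] + f zero   ∎
  Σ-agree-except f g (suc j) f≗g = begin
    f zero + Σ[ f ∘ suc ] + g (suc j)    ≡⟨ +-assoc (f zero) _ _ ⟩
    f zero + (Σ[ f ∘ suc ] + g (suc j))  ≡⟨ cong₂ _+_ (f≗g zero λ ())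
                                                       (Σ-agree-except (f ∘ suc) (g ∘ suc) j
                                                          (λ i i≢j → f≗g (suc i) (i≢j ∘ suc-injective))) ⟩
    g zero + (Σ[ g ∘ suc ] + f (suc j))  ≡⟨ +-assoc (g zero) _ _ ⟨
    g zero + Σ[ g ∘ suc ] + f (suc j)    ∎

  Σ-indicator : ∀ {n} (Γ : Graph n) {m} (b : Fin m → Bool) →
                Σ[ (λ i → if b i then 1# else 0#) ] ≡ fromℕ (sumℕ Γ (λ i → if b i then 1 else 0))
  Σ-indicator Γ {ℕ.zero} b = refl
  Σ-indicator Γ {suc m}  b with b zero
  ... | true  = cong (1# +_) (Σ-indicator Γ (b ∘ suc))
  ... | false = trans (+-identityˡ _) (Σ-indicator Γ (b ∘ suc))

module _ (R : RealField) where
  open RealField R hiding (_≤_)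
  open Linear R
  open RealFieldProperties R
  open CommutativeRing commutativeRing using (+-identityˡ; *-comm; zeroˡ)
  open ≡-Reasoning

  module _ {n} {Γ : Graph n} {θ : ℝ} {E : Matrix n} (W : OneWalkRegularIdempotent Γ θ E) where
    open OneWalkRegularIdempotent W

    Σ-row² : ∀ x → Σ[ (λ z → E x z * E x z) ] ≡ α₀
    Σ-row² x = trans (Σ-cong (λ z → cong (E x z *_) (symmetric x z))) (trans (idem x x) (diag x))

    α₀≢0 : α₀ ≢ 0#
    α₀≢0 α₀≡0 = ¬¬-∀-Fin (λ x → ¬¬-∀-Fin (λ z → x*x≡0⇒¬¬x≡0 (row²≡0 x z))) nonzero
      where
      row²≡0 : ∀ x z → E x z * E x z ≡ 0#
      row²≡0 x = Σ≡0⇒≡0 (λ z → 0≤x*x (E x z)) (trans (Σ-row² x) α₀≡0)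

    Amat*E≡Amat*α₁ : ∀ x z → Amat Γ x z * E z x ≡ Amat Γ x z * α₁
    Amat*E≡Amat*α₁ x z with Graph.adj Γ x z in x~z
    ... | true  = cong (1# *_) (offdiag z x (trans (Graph.sym Γ z x) x~z))
    ... | false = trans (zeroˡ (E z x)) (sym (zeroˡ α₁))

    θα₀≡kα₁ : ∀ {k} → Regular Γ k → Fin n → θ * α₀ ≡ fromℕ k * α₁
    θα₀≡kα₁ {k} regular x = begin
      θ * α₀                           ≡⟨ cong (θ *_) (diag x) ⟨
      θ * E x x                        ≡⟨ eigen x x ⟨
      Σ[ (λ z → Amat Γ x z * E z x) ]  ≡⟨ Σ-cong (Amat*E≡Amat*α₁ x) ⟩
      Σ[ (λ z → Amat Γ x z * α₁) ]     ≡⟨ Σ-distribʳ (Amat Γ x) α₁ ⟨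
      Σ[ Amat Γ x ] * α₁               ≡⟨ cong (_* α₁) (Σ-indicator Γ (Graph.adj Γ x)) ⟩
      fromℕ (degree Γ x) * α₁          ≡⟨ cong (λ d → fromℕ d * α₁) (regular x) ⟩
      fromℕ k * α₁                     ∎

    α₀≢α₁ : ∀ {k} → Regular Γ k → θ ≢ fromℕ k → Fin n → α₀ ≢ α₁
    α₀≢α₁ {k} regular θ≢k x α₀≡α₁ = α₀≢0 (*-cancelˡ-≢ α₀ θ≢k (begin
      α₀ * θ        ≡⟨ *-comm α₀ θ ⟩
      θ * α₀        ≡⟨ θα₀≡kα₁ regular x ⟩
      fromℕ k * α₁  ≡⟨ cong (fromℕ k *_) α₀≡α₁ ⟨
      fromℕ k * α₀  ≡⟨ *-comm (fromℕ k) α₀ ⟩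
      α₀ * fromℕ k  ∎))

    clique⇒independentColumns : α₀ ≢ α₁ → ∀ {r} (f : Fin (suc r) → Fin n) →
                                IsClique Γ f → IndependentColumns E (f ∘ suc)
    clique⇒independentColumns α₀≢α₁ f (_ , adjacent) a relation j =
      *-cancelˡ-≢ (a j) α₀≢α₁ (begin
        a j * α₀             ≡⟨ cong (a j *_) (diag _) ⟨
        rowⱼ j               ≡⟨ +-identityˡ _ ⟨
        0# + rowⱼ j          ≡⟨ cong (_+ rowⱼ j) (relation (f zero)) ⟨
        Σ[ rowₑ ] + rowⱼ j   ≡⟨ Σ-agree-except rowⱼ rowₑ j rows-agree ⟨
        Σ[ rowⱼ ] + rowₑ j   ≡⟨ cong (_+ rowₑ j) (relation (f (suc j))) ⟩
        0# + rowₑ j          ≡⟨ +-identityˡ _ ⟩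
        rowₑ j               ≡⟨ cong (a j *_) (e~xᵢ j) ⟩
        a j * α₁             ∎)
      where
      rowₑ rowⱼ : Fin _ → ℝ
      rowₑ i = a i * E (f zero) (f (suc i))
      rowⱼ i = a i * E (f (suc j)) (f (suc i))
      e~xᵢ : ∀ i → E (f zero) (f (suc i)) ≡ α₁
      e~xᵢ i = offdiag _ _ (adjacent zero (suc i) λ ())
      rows-agree : ∀ i → i ≢ j → rowⱼ i ≡ rowₑ i
      rows-agree i i≢j = cong (a i *_)
        (trans (offdiag _ _ (adjacent _ _ (i≢j ∘ sym ∘ suc-injective))) (sym (e~xᵢ i)))

proposition6p6 :
    (R : RealField) →
    (n : ℕ) (Γ : Graph n) → Connected Γ → OneWalkRegular Γ →
    (k : ℕ) → Regular Γ k →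
    (θ : RealField.ℝ R) → θ ≢ Linear.fromℕ R k →
    (E : Linear.Matrix R n) → Linear.OneWalkRegularIdempotent R Γ θ E →
    (m : ℕ) → Linear.HasRank R E m →
    (c : ℕ) (f : Fin c → Fin n) → IsClique Γ f →
    c ≤ suc m
proposition6p6 R n Γ _ ((x , _) , _) k regular θ θ≢k E W m (_ , rank-bound) c f clique
  with c ≤? suc m
... | yes c≤1+m = c≤1+m
... | no  c≰1+m =
  contradiction (clique⇒independentColumns R W (α₀≢α₁ R W regular θ≢k x) f′
                   (IsClique-inject≤ Γ clique m+2≤c))
                (rank-bound (f′ ∘ suc))
  where
  m+2≤c : suc (suc m) ≤ c
  m+2≤c = ≰⇒> c≰1+m
  f′ : Fin (suc (suc m)) → Fin n
  f′ i = f (inject≤ i m+2≤c)
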